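{- In Algorithm EA (setting in the context), for every time $t\in\{1,\dots,m\}$, every pair of vertices $u,v$ with $uv\in E$ and every set $Q\subseteq E\setminus\{uv\}$ of $t-1$ edges, given $e_t=uv$ and $E_{t-1}=Q$, it holds that $x_t\ge\alpha_t$.
   Context: Setting (secretary matching with edge arrival): $G=(V,E)$ is a graph with $m$ edges (with $m$ known) and edge weights $w_e\ge 0$ unknown in advance; standing assumption: for every $S\subseteq E$ the maximum weight matching of the graph $G(S)$ with edge set $S$ is unique. The edges arrive in a uniformly random order $e_1,\dots,e_m$; $E_t=\{e_1,\dots,e_t\}$; upon arrival of $e_t$ its weight is revealed and, if both endpoints are unmatched, the algorithm must immediately and irrevocably decide whether to add it to the matching. Define $\alpha_t=0$ if $t\le m/2$ and $\alpha_t=1-2\sum_{i=1}^{t-1}\frac{\alpha_i}{i}$ if $t>m/2$. Algorithm EA: let $A=V$ (available vertices), $\mu=\emptyset$. For $t=\lfloor m/2\rfloor+1,\dots,m$: let $e_t=uv$; let $x_t$ be the probability that both $u,v\in A$ at the start of round $t$, where the probability is over a uniformly random order of the edges of $E_{t-1}$ (with $e_t$ and the set $E_{t-1}$ fixed) and the algorithm's random choices in rounds $1,\dots,t-1$; let $\mu^*_t$ be the maximum weight matching of $G(E_t)$; if $e_t\in\mu^*_t$ and $u,v\in A$, then with probability $\alpha_t/x_t$ add $e_t$ to $\mu$ and remove $u,v$ from $A$. Return $\mu$.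
   Formalization: The edge weights are nonnegative rationals instead of real numbers. -}

module Defs where

open import Data.Bool using (Bool; true; false; if_then_else_)
open import Data.Nat as ℕ using (ℕ; zero; suc)
open import Data.Fin using (Fin)
open import Data.Fin.Properties using (all?)
open import Data.Fin.Subset using (Subset; _∈_; _∉_; _⊆_; ⊤; ⁅_⁆; _∪_; ∣_∣; inside; outside)
import Data.Fin.Subset as Sub
open import Data.Fin.Subset.Properties using (_∈?_; _⊆?_; anySubset?)
open import Data.Vec using (allFin; toList)
open import Data.List using (List; []; _∷_; map; concatMap; foldr; filter; length)
open import Data.Product using (_×_; _,_; proj₁; proj₂; ∃; ∃-syntax)
open import Data.Rational using (ℚ; 0ℚ; 1ℚ; _+_; _*_; _-_; _÷_; _≤_; _/_; ≢-nonZero)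
open import Data.Rational.Properties using (_≤?_; _≟_)
open import Data.Integer using (+_)
open import Relation.Nullary using (Dec; yes; no; ¬_; does; ¬?)
open import Relation.Nullary.Decidable using (_×-dec_; _→-dec_; map′; decidable-stable)
open import Relation.Binary.PropositionalEquality using (_≡_; _≢_)
import Data.Fin.Properties as FinP

insertions : {A : Set} → A → List A → List (List A)
insertions x []       = (x ∷ []) ∷ []
insertions x (y ∷ ys) = (x ∷ y ∷ ys) ∷ map (y ∷_) (insertions x ys)

permutations : {A : Set} → List A → List (List A)
permutations []       = [] ∷ []
permutations (x ∷ xs) = concatMap (insertions x) (permutations xs)

sumℚ : List ℚ → ℚ
sumℚ = foldr _+_ 0ℚ

-- arithmetic mean (0 for the empty list)
average : List ℚ → ℚ
average []       = 0ℚ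
average (y ∷ ys) = sumℚ (y ∷ ys) * (+ 1 / suc (length ys))

-- The sequence α_t (depends on m):
--   α_t = 0 if t ≤ m/2,  α_t = 1 - 2 Σ_{i=1}^{t-1} α_i / i  if t > m/2.
mutual
  α : (m : ℕ) → ℕ → ℚ
  α m zero    = 0ℚ
  α m (suc k) = if m ℕ.<ᵇ 2 ℕ.* suc k then 1ℚ - (+ 2 / 1) * αsum m k else 0ℚ

  αsum : (m : ℕ) → ℕ → ℚ
  αsum m zero    = 0ℚ
  αsum m (suc k) = αsum m k + α m (suc k) * (+ 1 / suc k)

-- A graph with vertex set Fin n and edge set Fin m; edge e joins the two
-- endpoints  ends e .  Weights w : Fin m → ℚ.

module Graph (n m : ℕ) (ends : Fin m → Fin n × Fin n) (w : Fin m → ℚ) where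

  Disjoint : Fin m → Fin m → Set
  Disjoint e f = (proj₁ (ends e) ≢ proj₁ (ends f)) × (proj₁ (ends e) ≢ proj₂ (ends f))
               × (proj₂ (ends e) ≢ proj₁ (ends f)) × (proj₂ (ends e) ≢ proj₂ (ends f))

  -- M is a matching of the graph G(S) with edge set S
  IsMatching : Subset m → Subset m → Set
  IsMatching S M = M ⊆ S × (∀ e f → e ∈ M → f ∈ M → e ≢ f → Disjoint e f)

  weight : Subset m → ℚ
  weight M = sumℚ (map (λ e → if does (e ∈? M) then w e else 0ℚ) (toList (allFin m)))

  IsMaxWeightMatching : Subset m → Subset m → Set
  IsMaxWeightMatching S M =
    IsMatching S M × (∀ M' → IsMatching S M' → weight M' ≤ weight M)

  UniqueMaxWeightMatchings : Set
  UniqueMaxWeightMatchings =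
    ∀ S M M' → IsMaxWeightMatching S M → IsMaxWeightMatching S M' → M ≡ M'

  private
    ≢? : (a b : Fin n) → Dec (a ≢ b)
    ≢? a b = ¬? (a FinP.≟ b)

    ≢?m : (a b : Fin m) → Dec (a ≢ b)
    ≢?m a b = ¬? (a FinP.≟ b)

    disjoint? : ∀ e f → Dec (Disjoint e f)
    disjoint? e f = ≢? _ _ ×-dec (≢? _ _ ×-dec (≢? _ _ ×-dec ≢? _ _))

    allSubset? : {P : Subset m → Set} → (∀ M → Dec (P M)) → Dec (∀ M → P M)
    allSubset? {P} P? with anySubset? (λ M → ¬? (P? M))
    ... | yes (M , ¬p) = no (λ h → ¬p (h M))
    ... | no ¬ex       = yes (λ M → decidable-stable (P? M) (λ ¬p → ¬ex (M , ¬p)))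

  isMatching? : ∀ S M → Dec (IsMatching S M)
  isMatching? S M = (M ⊆? S) ×-dec
    all? (λ e → all? (λ f → (e ∈? M) →-dec ((f ∈? M) →-dec (≢?m e f →-dec disjoint? e f))))

  isMaxWeightMatching? : ∀ S M → Dec (IsMaxWeightMatching S M)
  isMaxWeightMatching? S M = isMatching? S M ×-dec
    allSubset? (λ M' → isMatching? S M' →-dec (weight M' ≤? weight M))

  InMaxMatching : Subset m → Fin m → Set
  InMaxMatching S e = ∃[ M ] (IsMaxWeightMatching S M × e ∈ M)

  inMaxMatching? : ∀ S e → Dec (InMaxMatching S e)
  inMaxMatching? S e = anySubset? (λ M → isMaxWeightMatching? S M ×-dec (e ∈? M))

  -- Algorithm EA.  The state is the set A ⊆ V of available vertices; a
  -- (sub)distribution over states is a list of (probability, state) pairs.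

  Dist : Set
  Dist = List (ℚ × Subset n)

  setOf : List (Fin m) → Subset m
  setOf = foldr (λ e S → ⁅ e ⁆ ∪ S) Sub.⊥

  BothAvailable : Fin m → Subset n → Set
  BothAvailable e A = (proj₁ (ends e) ∈ A) × (proj₂ (ends e) ∈ A)

  bothAvailable? : ∀ e A → Dec (BothAvailable e A)
  bothAvailable? e A = (proj₁ (ends e) ∈? A) ×-dec (proj₂ (ends e) ∈? A)

  probAvail : Fin m → Dist → ℚ
  probAvail e D = sumℚ (map (λ pA → if does (bothAvailable? e (proj₂ pA)) then proj₁ pA else 0ℚ) D)

  -- α_t / x_t  (the value when x_t = 0 is irrelevant: then the branch has probability 0)
  ratio : ℚ → ℚ → ℚ
  ratio a x with x ≟ 0ℚ
  ... | yes _  = 0ℚ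
  ... | no x≢0 = _÷_ a x {{≢-nonZero x≢0}}

  -- round t with edge e = e_t, E_t = S, x = x_t, applied to the distribution D
  -- of A at the start of round t
  step : (t : ℕ) → Fin m → Subset m → ℚ → Dist → Dist
  step t e S x D =
    if (m ℕ.<ᵇ 2 ℕ.* t) ∧' does (inMaxMatching? S e)
    then concatMap branch D
    else D
    where
      _∧'_ : Bool → Bool → Bool
      true  ∧' b = b
      false ∧' b = false
      q : ℚ
      q = ratio (α m t) x
      branch : ℚ × Subset n → Dist
      branch (p , A) =
        if does (bothAvailable? e A)
        then ((p * q , (A Sub.- proj₁ (ends e)) Sub.- proj₂ (ends e)) ∷ (p * (1ℚ - q) , A) ∷ [])
        else ((p , A) ∷ [])

  -- distR f (e_k ∷ … ∷ e_1 ∷ []) : distribution of A after rounds 1..k when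
  -- the first k edges arrive in order e_1,…,e_k  (fuel f ≥ k).
  -- xR f rs e : the probability x_t that both endpoints of e = e_t are in A at
  -- the start of round t = length rs + 1, over a uniformly random order of the
  -- edges of rs (= E_{t-1}) and the algorithm's coins.
  mutual
    distR : ℕ → List (Fin m) → Dist
    distR _       []       = (1ℚ , ⊤) ∷ []
    distR zero    (_ ∷ _)  = []
    distR (suc f) (e ∷ rs) = step (suc (length rs)) e (setOf (e ∷ rs)) (xR f rs e) (distR f rs)

    xR : ℕ → List (Fin m) → Fin m → ℚ
    xR f rs e = average (map (λ ord → probAvail e (distR f ord)) (permutations rs))

  elements : Subset m → List (Fin m)
  elements Q = filter (_∈? Q) (toList (allFin m))

  -- x_t given e_t = e and E_{t-1} = Q
  x : Subset m → Fin m → ℚ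
  x Q e = xR (length (elements Q)) (elements Q) e

open import Data.Sum using (_⊎_)
open import Data.Product using (swap)

IsSimpleGraph : {n m : ℕ} → (Fin m → Fin n × Fin n) → Set
IsSimpleGraph {n} {m} ends =
  (∀ e → proj₁ (ends e) ≢ proj₂ (ends e)) ×
  (∀ e f → (ends e ≡ ends f) ⊎ (ends e ≡ swap (ends f)) → e ≡ f)

module Submission where

-- For a list L of k distinct edges and an edge e, xR k L e is the probability that both ends of e
-- are still available after the algorithm has processed the edges of L in a uniformly random order.
-- By induction on k, xR k L e ≥ β m k = 1 − 2 Σ_{i ≤ k} α_i / i, and α_{k+1} is either β m k or 0.
-- A uniformly random order of L consists of a uniformly random last edge y and an independent
-- uniformly random order of the remaining edges ys.  The last round can only make e unavailable if y shares an end
-- with e and lies in the maximum weight matching μ*(L); it then fires with probability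
-- α_k / xR (k - 1) ys y whenever both ends of y are available, so with probability at most α_k.
-- As μ*(L) has at most two edges touching e, averaging over y costs at most 2 α_k / k, which
-- turns β m (k - 1) into β m k.  The same induction keeps α_t / x_t ≤ 1, so the weights of the
-- distributions stay nonnegative.

open import Data.Bool using (true; false; if_then_else_; _∧_; not)
open import Data.Nat as ℕ using (ℕ; zero; suc; _!; _≤_; _<_; _<?_; _∸_)
import Data.Nat.Properties as ℕₚ
open import Data.Integer as ℤ using (+_)
import Data.Integer.Properties as ℤₚ
open import Data.Nat.Coprimality using (1-coprimeTo)
open import Data.Rational using (ℚ; 0ℚ; 1ℚ; _+_; _*_; _-_; -_; _/_; 1/_; mkℚ; nonNegative; ≢-nonZero)
open import Data.Rational using () renaming (_≤_ to _≤ℚ_)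
open import Data.Rational.Literals using (fromℤ)
open import Data.Rational.Properties as ℚ
  using (≤-refl; ≤-trans; ≤-reflexive; +-mono-≤; nonNegative⁻¹; +-0-isCommutativeMonoid; +-*-commutativeRing)
open import Tactic.RingSolver.Core.AlmostCommutativeRing using (AlmostCommutativeRing; fromCommutativeRing)
open import Tactic.RingSolver using (solve-∀)
open import Data.Product using (_×_; _,_; proj₁; proj₂; map₂)
open import Data.Sum using (_⊎_; inj₁; inj₂; [_,_])
import Data.Sum
open import Data.List using (List; []; _∷_; map; concatMap; length; _++_; filter)
import Data.List as List
open import Data.List.Properties
  using (map-∘; map-++; length-map; length-++; concatMap-++; concatMap-map; map-concatMap; concatMap-cong; map-tabulate)
open import Data.List.Relation.Unary.All using (All; []; _∷_)
import Data.List.Relation.Unary.All as All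
import Data.List.Relation.Unary.All.Properties as All
open import Data.List.Relation.Unary.AllPairs using ([]; _∷_)
open import Data.List.Relation.Unary.Unique.Propositional using (Unique)
import Data.List.Relation.Unary.Unique.Propositional.Properties as Uniqueₚ
open import Data.List.Relation.Binary.Permutation.Propositional as ↭
  using (_↭_; ↭-refl; ↭-prep; ↭-swap; ↭-sym; ↭-trans; ↭-reflexive; ↭⇒↭ₛ)
open import Data.List.Relation.Binary.Permutation.Propositional.Properties using (map⁺; ↭-length; ++⁺ˡ; ++⁺; shifts)
import Data.List.Relation.Binary.Permutation.Setoid.Properties as Setoid↭
open import Data.Vec using ([]; _∷_; there)
import Data.Vec as Vec
open import Data.Fin as Fin using (Fin)
open import Data.Fin.Subset as Sub using (Subset; _∈_; _∉_; _─_; _∪_; ⁅_⁆; ∣_∣; inside; outside)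
open import Data.Fin.Subset.Properties
  using (p─q⊆p; x∈p∧x≢y⇒x∈p-y; x∈⁅x⁆; _∈?_; anySubset?; ∪-assoc; ∪-comm; ∈⊤)
open import Function using (_∘_; id)
open import Function.Bundles using (_⇔_; mk⇔; Equivalence)
open Equivalence using (to; from)
open import Relation.Nullary using (Dec; yes; no; does; ¬_; ¬?; contradiction)
open import Relation.Nullary.Decidable using (_×-dec_; _⊎-dec_; does-⇔; dec⇒maybe; dec-true; dec-false)
open import Relation.Binary.PropositionalEquality
  using (_≡_; _≢_; refl; sym; trans; cong; cong₂; subst; setoid; module ≡-Reasoning)

open import Defs

private variable
  A B C : Set

ℚ-ring : AlmostCommutativeRing _ _
ℚ-ring = fromCommutativeRing +-*-commutativeRing (λ x → dec⇒maybe (0ℚ ℚ.≟ x))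

fromℕ : ℕ → ℚ
fromℕ k = fromℤ (+ k)

fromℕ-suc : ∀ k → fromℕ (suc k) ≡ 1ℚ + fromℕ k
fromℕ-suc k = trans (sym (ℚ.↥p/↧p≡p (fromℕ (suc k)))) (cong (_/ 1) (cong (ℤ._+_ (+ 1)) (sym (ℤₚ.*-identityʳ (+ k)))))

fromℕ-* : ∀ a b → fromℕ (a ℕ.* b) ≡ fromℕ a * fromℕ b
fromℕ-* a b = trans (sym (ℚ.↥p/↧p≡p (fromℕ (a ℕ.* b)))) (cong (_/ 1) (ℤₚ.pos-* a b))

fromℕ-nonNeg : ∀ k → 0ℚ ≤ℚ fromℕ k
fromℕ-nonNeg k = nonNegative⁻¹ (fromℕ k)

fromℕ-suc*inverse : ∀ k → fromℕ (suc k) * (+ 1 / suc k) ≡ 1ℚ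
fromℕ-suc*inverse k = trans (cong (fromℕ (suc k) *_) (ℚ.↥p/↧p≡p (mkℚ (+ 1) k (1-coprimeTo (suc k)))))
                            (ℚ.*-inverseʳ (fromℕ (suc k)))

1/suc-nonNeg : ∀ k → 0ℚ ≤ℚ + 1 / suc k
1/suc-nonNeg k = nonNegative⁻¹ (+ 1 / suc k) {{ℚ.normalize-nonNeg 1 (suc k)}}

*-nonNeg : ∀ {p q} → 0ℚ ≤ℚ p → 0ℚ ≤ℚ q → 0ℚ ≤ℚ p * q
*-nonNeg {p} {q} 0≤p 0≤q =
  nonNegative⁻¹ (p * q) {{ℚ.nonNeg*nonNeg⇒nonNeg p {{nonNegative 0≤p}} q {{nonNegative 0≤q}}}}

1/-nonNeg : ∀ x → 0ℚ ≤ℚ x → (x≢0 : x ≢ 0ℚ) → 0ℚ ≤ℚ (1/ x) {{≢-nonZero x≢0}}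
1/-nonNeg x 0≤x x≢0 = ℚ.<⇒≤ (ℚ.positive⁻¹ _ {{ℚ.1/pos⇒pos x {{pos}}}})
  where
  pos = ℚ.nonNeg∧nonZero⇒pos x {{nonNegative 0≤x}} {{≢-nonZero x≢0}}

-‿mono-≤ : ∀ {p q r s} → q ≤ℚ p → r ≤ℚ s → q - s ≤ℚ p - r
-‿mono-≤ q≤p r≤s = +-mono-≤ q≤p (ℚ.neg-antimono-≤ r≤s)

p-q≤p : ∀ p {q} → 0ℚ ≤ℚ q → p - q ≤ℚ p
p-q≤p p {q} 0≤q = ≤-trans (-‿mono-≤ (≤-refl {p}) 0≤q) (≤-reflexive (ℚ.+-identityʳ p))

p≤p+q : ∀ p {q} → 0ℚ ≤ℚ q → p ≤ℚ p + q
p≤p+q p {q} 0≤q = ≤-trans (≤-reflexive (sym (ℚ.+-identityʳ p))) (+-mono-≤ (≤-refl {p}) 0≤q)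

q≤1⇒0≤1-q : ∀ {q} → q ≤ℚ 1ℚ → 0ℚ ≤ℚ 1ℚ - q
q≤1⇒0≤1-q {q} q≤1 = ≤-trans (≤-reflexive (sym (ℚ.+-inverseʳ q))) (ℚ.+-monoˡ-≤ (- q) q≤1)

-- Sums and averages over lists

sumℚ-++ : ∀ xs ys → sumℚ (xs ++ ys) ≡ sumℚ xs + sumℚ ys
sumℚ-++ []       ys = sym (ℚ.+-identityˡ (sumℚ ys))
sumℚ-++ (x ∷ xs) ys = trans (cong (_+_ x) (sumℚ-++ xs ys)) (sym (ℚ.+-assoc x (sumℚ xs) (sumℚ ys)))

sumℚ-↭ : ∀ {xs ys} → xs ↭ ys → sumℚ xs ≡ sumℚ ys
sumℚ-↭ xs↭ys = Setoid↭.foldr-commMonoid (setoid ℚ) +-0-isCommutativeMonoid (↭⇒↭ₛ xs↭ys)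

∑ : (A → ℚ) → List A → ℚ
∑ F xs = sumℚ (map F xs)

∑-↭ : (F : A → ℚ) {xs ys : List A} → xs ↭ ys → ∑ F xs ≡ ∑ F ys
∑-↭ F xs↭ys = sumℚ-↭ (map⁺ F xs↭ys)

∑-map : (F : B → ℚ) (g : A → B) (xs : List A) → ∑ F (map g xs) ≡ ∑ (λ x → F (g x)) xs
∑-map F g xs = cong sumℚ (sym (map-∘ xs))

∑-concatMap : (F : B → ℚ) (g : A → List B) (xs : List A) →
              ∑ F (concatMap g xs) ≡ ∑ (λ x → ∑ F (g x)) xs
∑-concatMap F g []       = refl
∑-concatMap F g (x ∷ xs) = begin
  sumℚ (map F (g x ++ concatMap g xs))        ≡⟨ cong sumℚ (map-++ F (g x) _) ⟩
  sumℚ (map F (g x) ++ map F (concatMap g xs)) ≡⟨ sumℚ-++ (map F (g x)) _ ⟩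
  ∑ F (g x) + ∑ F (concatMap g xs)             ≡⟨ cong (_+_ (∑ F (g x))) (∑-concatMap F g xs) ⟩
  ∑ F (g x) + ∑ (λ x → ∑ F (g x)) xs           ∎
  where open ≡-Reasoning

∑-mono : {F G : A → ℚ} (xs : List A) → All (λ x → F x ≤ℚ G x) xs → ∑ F xs ≤ℚ ∑ G xs
∑-mono []       []         = ≤-refl
∑-mono (x ∷ xs) (Fx≤Gx ∷ h) = +-mono-≤ Fx≤Gx (∑-mono xs h)

∑-nonNeg : {F : A → ℚ} (xs : List A) → All (λ x → 0ℚ ≤ℚ F x) xs → 0ℚ ≤ℚ ∑ F xs
∑-nonNeg []       []        = ≤-refl
∑-nonNeg (x ∷ xs) (0≤Fx ∷ h) = +-mono-≤ 0≤Fx (∑-nonNeg xs h)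

∑-+ : (F G : A → ℚ) (xs : List A) → ∑ (λ x → F x + G x) xs ≡ ∑ F xs + ∑ G xs
∑-+ F G []       = refl
∑-+ F G (x ∷ xs) = trans (cong (_+_ (F x + G x)) (∑-+ F G xs)) (lemma (F x) (G x) (∑ F xs) (∑ G xs))
  where
  lemma : ∀ a b c d → a + b + (c + d) ≡ a + c + (b + d)
  lemma = solve-∀ ℚ-ring

∑-linear : (F G : A → ℚ) (c : ℚ) (xs : List A) → ∑ (λ x → F x - c * G x) xs ≡ ∑ F xs - c * ∑ G xs
∑-linear F G c []       = lemma c
  where
  lemma : ∀ c → 0ℚ ≡ 0ℚ - c * 0ℚ
  lemma = solve-∀ ℚ-ring
∑-linear F G c (x ∷ xs) = trans (cong (_+_ (F x - c * G x)) (∑-linear F G c xs))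
                                (lemma (F x) (G x) c (∑ F xs) (∑ G xs))
  where
  lemma : ∀ a b c d e → a - c * b + (d - c * e) ≡ a + d - c * (b + e)
  lemma = solve-∀ ℚ-ring

∑-const : (c : ℚ) (xs : List A) → ∑ (λ _ → c) xs ≡ fromℕ (length xs) * c
∑-const c []       = sym (ℚ.*-zeroˡ c)
∑-const c (x ∷ xs) = begin
  c + ∑ (λ _ → c) xs             ≡⟨ cong (_+_ c) (∑-const c xs) ⟩
  c + fromℕ (length xs) * c      ≡⟨ lemma c (fromℕ (length xs)) ⟩
  (1ℚ + fromℕ (length xs)) * c   ≡⟨ cong (_* c) (sym (fromℕ-suc (length xs))) ⟩
  fromℕ (suc (length xs)) * c    ∎
  where
  open ≡-Reasoning
  lemma : ∀ c n → c + n * c ≡ (1ℚ + n) * c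
  lemma = solve-∀ ℚ-ring

average-nonNeg : (F : A → ℚ) (xs : List A) → All (λ x → 0ℚ ≤ℚ F x) xs → 0ℚ ≤ℚ average (map F xs)
average-nonNeg F []       _ = ≤-refl
average-nonNeg F (x ∷ xs) h = *-nonNeg (∑-nonNeg (x ∷ xs) h) (1/suc-nonNeg (length (map F xs)))

∑≡length*average : (F : A → ℚ) (xs : List A) → 0 < length xs →
                   ∑ F xs ≡ fromℕ (length xs) * average (map F xs)
∑≡length*average F (x ∷ xs) _ = begin
  s                                            ≡⟨ sym (ℚ.*-identityʳ s) ⟩
  s * 1ℚ                                       ≡⟨ cong (s *_) (sym (fromℕ-suc*inverse k)) ⟩
  s * (fromℕ (suc k) * (+ 1 / suc k))          ≡⟨ lemma s (fromℕ (suc k)) (+ 1 / suc k) ⟩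
  fromℕ (suc k) * (s * (+ 1 / suc k))          ≡⟨ cong (λ l → fromℕ (suc k) * (s * (+ 1 / suc l))) (sym (length-map F xs)) ⟩
  fromℕ (suc k) * average (map F (x ∷ xs))     ∎
  where
  open ≡-Reasoning
  s = ∑ F (x ∷ xs)
  k = length xs
  lemma : ∀ a b c → a * (b * c) ≡ b * (a * c)
  lemma = solve-∀ ℚ-ring

average-≥ : (F : A → ℚ) (xs : List A) {b : ℚ} → 0 < length xs →
            fromℕ (length xs) * b ≤ℚ ∑ F xs → b ≤ℚ average (map F xs)
average-≥ F (x ∷ xs) {b} _ nb≤s = begin
  b                                       ≡⟨ sym (ℚ.*-identityʳ b) ⟩
  b * 1ℚ                                  ≡⟨ cong (b *_) (sym (fromℕ-suc*inverse k)) ⟩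
  b * (fromℕ (suc k) * (+ 1 / suc k))     ≡⟨ ℚ.*-assoc b _ _ ⟨
  b * fromℕ (suc k) * (+ 1 / suc k)       ≡⟨ cong (_* (+ 1 / suc k)) (ℚ.*-comm b (fromℕ (suc k))) ⟩
  fromℕ (suc k) * b * (+ 1 / suc k)       ≤⟨ ℚ.*-monoʳ-≤-nonNeg (+ 1 / suc k) {{nonNegative (1/suc-nonNeg k)}} nb≤s ⟩
  ∑ F (x ∷ xs) * (+ 1 / suc k)            ≡⟨ cong (λ l → ∑ F (x ∷ xs) * (+ 1 / suc l)) (sym (length-map F xs)) ⟩
  average (map F (x ∷ xs))                ∎
  where
  open ℚ.≤-Reasoning
  k = length xs

average-↭ : (F : A → ℚ) {xs ys : List A} → xs ↭ ys → average (map F xs) ≡ average (map F ys)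
average-↭ F {[]}     {[]}     _     = refl
average-↭ F {x ∷ xs} {y ∷ ys} xs↭ys =
  cong₂ (λ s l → s * (+ 1 / suc l)) (∑-↭ F xs↭ys)
        (trans (length-map F xs) (trans (ℕₚ.suc-injective (↭-length xs↭ys)) (sym (length-map F ys))))
average-↭ F {[]}     {_ ∷ _}  xs↭ys with () ← ↭-length xs↭ys
average-↭ F {_ ∷ _}  {[]}     xs↭ys with () ← ↭-length xs↭ys

𝟙 : {P : Set} → Dec P → ℚ
𝟙 P? = if does P? then 1ℚ else 0ℚ

𝟙-nonNeg : {P : Set} (P? : Dec P) → 0ℚ ≤ℚ 𝟙 P?
𝟙-nonNeg P? with does P?
... | true  = nonNegative⁻¹ 1ℚ
... | false = ≤-refl

𝟙-mono : {P Q : Set} (P? : Dec P) (Q? : Dec Q) → (P → Q) → 𝟙 P? ≤ℚ 𝟙 Q?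
𝟙-mono P?      Q?       P⇒Q with P? | Q?
... | yes _ | yes _ = ≤-refl
... | yes p | no ¬q = contradiction (P⇒Q p) ¬q
... | no _  | Q?′   = 𝟙-nonNeg Q?′

𝟙-⊎ : {P Q : Set} (P? : Dec P) (Q? : Dec Q) → 𝟙 (P? ⊎-dec Q?) ≤ℚ 𝟙 P? + 𝟙 Q?
𝟙-⊎ P? Q? with P?
... | yes _ = p≤p+q 1ℚ (𝟙-nonNeg Q?)
... | no  _ = ≤-reflexive (sym (ℚ.+-identityˡ (𝟙 Q?)))

∑-𝟙-none : {P : A → Set} (P? : ∀ x → Dec (P x)) (xs : List A) →
           All (λ x → ¬ P x) xs → ∑ (λ x → 𝟙 (P? x)) xs ≡ 0ℚ
∑-𝟙-none P? []       []         = refl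
∑-𝟙-none P? (x ∷ xs) (¬Px ∷ ¬P) =
  cong₂ _+_ (cong (if_then 1ℚ else 0ℚ) (dec-false (P? x) ¬Px)) (∑-𝟙-none P? xs ¬P)

∑-𝟙-≤1 : {P : A → Set} (P? : ∀ x → Dec (P x)) → (∀ {a b} → P a → P b → a ≡ b) →
         (xs : List A) → Unique xs → ∑ (λ x → 𝟙 (P? x)) xs ≤ℚ 1ℚ
∑-𝟙-≤1 P? atMostOne []       []           = nonNegative⁻¹ 1ℚ
∑-𝟙-≤1 P? atMostOne (x ∷ xs) (x∉xs ∷ uxs) with P? x
... | yes Px = ≤-reflexive (trans (cong (_+_ 1ℚ) (∑-𝟙-none P? xs (All.map (λ x≢y Py → x≢y (atMostOne Px Py)) x∉xs)))
                                  (ℚ.+-identityʳ 1ℚ))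
... | no  _  = ≤-trans (≤-reflexive (ℚ.+-identityˡ _)) (∑-𝟙-≤1 P? atMostOne xs uxs)

-- Permutations

concatMap-↭ : (f : A → List B) {xs ys : List A} → xs ↭ ys → concatMap f xs ↭ concatMap f ys
concatMap-↭ f ↭.refl                = ↭-refl
concatMap-↭ f (↭.prep x xs↭ys)      = ++⁺ˡ (f x) (concatMap-↭ f xs↭ys)
concatMap-↭ f (↭.swap x y xs↭ys)    = ↭-trans (shifts (f x) (f y)) (++⁺ˡ (f y) (++⁺ˡ (f x) (concatMap-↭ f xs↭ys)))
concatMap-↭ f (↭.trans xs↭ys ys↭zs) = ↭-trans (concatMap-↭ f xs↭ys) (concatMap-↭ f ys↭zs)

concatMap-cong-↭ : {f g : A → List B} → (∀ x → f x ↭ g x) → (xs : List A) → concatMap f xs ↭ concatMap g xs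
concatMap-cong-↭ f↭g []       = ↭-refl
concatMap-cong-↭ f↭g (x ∷ xs) = ++⁺ (f↭g x) (concatMap-cong-↭ f↭g xs)

concatMap-∷ : (f : A → B) (g : A → List B) (xs : List A) →
              concatMap (λ x → f x ∷ g x) xs ↭ map f xs ++ concatMap g xs
concatMap-∷ f g []       = ↭-refl
concatMap-∷ f g (x ∷ xs) = ↭-prep (f x) (↭-trans (++⁺ˡ (g x) (concatMap-∷ f g xs)) (shifts (g x) (map f xs)))

concatMap-concatMap : (f : B → List C) (g : A → List B) (xs : List A) →
                      concatMap f (concatMap g xs) ≡ concatMap (λ x → concatMap f (g x)) xs
concatMap-concatMap f g []       = refl
concatMap-concatMap f g (x ∷ xs) =
  trans (concatMap-++ f (g x) _) (cong (concatMap f (g x) ++_) (concatMap-concatMap f g xs))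

length-concatMap : (f : A → List B) {c : ℕ} (xs : List A) →
                   All (λ x → length (f x) ≡ c) xs → length (concatMap f xs) ≡ length xs ℕ.* c
length-concatMap f []       []          = refl
length-concatMap f (x ∷ xs) (|fx|≡c ∷ h) =
  trans (length-++ (f x)) (cong₂ ℕ._+_ |fx|≡c (length-concatMap f xs h))

Unique-↭ : {xs ys : List A} → xs ↭ ys → Unique xs → Unique ys
Unique-↭ {A = A} xs↭ys = Setoid↭.Unique-resp-↭ (setoid A) (↭⇒↭ₛ xs↭ys)

insertions-↭ : (x : A) (p : List A) → All (_↭ x ∷ p) (insertions x p)
insertions-↭ x []       = ↭-refl ∷ []
insertions-↭ x (y ∷ ys) =
  ↭-refl ∷ All.map⁺ (All.map (λ q↭x∷ys → ↭-trans (↭-prep y q↭x∷ys) (↭-swap y x ↭-refl)) (insertions-↭ x ys))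

permutations-↭ : (L : List A) → All (_↭ L) (permutations L)
permutations-↭ []       = ↭-refl ∷ []
permutations-↭ (x ∷ xs) = All.concat⁺ (All.map⁺ (All.map
  (λ {p} p↭xs → All.map (λ q↭x∷p → ↭-trans q↭x∷p (↭-prep x p↭xs)) (insertions-↭ x p))
  (permutations-↭ xs)))

laterInsertions : A → List A → List (List A)
laterInsertions x []       = []
laterInsertions x (z ∷ zs) = map (z ∷_) (insertions x zs)

insertions-∷ : (x : A) (p : List A) → insertions x p ≡ (x ∷ p) ∷ laterInsertions x p
insertions-∷ x []      = refl
insertions-∷ x (_ ∷ _) = refl

length-permutations : (L : List A) → length (permutations L) ≡ length L !
length-permutations []       = refl
length-permutations (x ∷ xs) = begin
  length (concatMap (insertions x) (permutations xs)) ≡⟨ length-concatMap (insertions x) (permutations xs) lengths ⟩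
  length (permutations xs) ℕ.* suc (length xs)        ≡⟨ cong (ℕ._* suc (length xs)) (length-permutations xs) ⟩
  length xs ! ℕ.* suc (length xs)                     ≡⟨ ℕₚ.*-comm (length xs !) (suc (length xs)) ⟩
  suc (length xs) !                                   ∎
  where
  open ≡-Reasoning
  length-insertions : ∀ p → length (insertions x p) ≡ suc (length p)
  length-insertions []       = refl
  length-insertions (y ∷ ys) = cong suc (trans (length-map (y ∷_) (insertions x ys)) (length-insertions ys))
  lengths : All (λ p → length (insertions x p) ≡ suc (length xs)) (permutations xs)
  lengths = All.map (λ {p} p↭xs → trans (length-insertions p) (cong suc (↭-length p↭xs))) (permutations-↭ xs)

insertions-comm : (x y : A) (p : List A) →
                  concatMap (insertions x) (insertions y p) ↭ concatMap (insertions y) (insertions x p)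
insertions-comm x y []       = ↭-swap _ _ ↭-refl
insertions-comm x y (z ∷ zs) = begin
  concatMap (insertions x) (insertions y (z ∷ zs))                  ↭⟨ expand x y ⟩
  (x ∷ y ∷ z ∷ zs) ∷ (y ∷ x ∷ z ∷ zs) ∷ (Y ++ X ++ map (z ∷_) (concatMap (insertions x) (insertions y zs)))
    ↭⟨ ↭-swap _ _ (↭-trans (shifts Y X) (++⁺ˡ X (++⁺ˡ Y (map⁺ (z ∷_) (insertions-comm x y zs))))) ⟩
  (y ∷ x ∷ z ∷ zs) ∷ (x ∷ y ∷ z ∷ zs) ∷ (X ++ Y ++ map (z ∷_) (concatMap (insertions y) (insertions x zs)))
    ↭⟨ expand y x ⟨
  concatMap (insertions y) (insertions x (z ∷ zs))                  ∎
  where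
  open ↭.PermutationReasoning
  X = map (λ w → x ∷ z ∷ w) (insertions y zs)
  Y = map (λ w → y ∷ z ∷ w) (insertions x zs)
  expand : ∀ x y → concatMap (insertions x) (insertions y (z ∷ zs)) ↭
           (x ∷ y ∷ z ∷ zs) ∷ (y ∷ x ∷ z ∷ zs) ∷
             (map (λ w → y ∷ z ∷ w) (insertions x zs) ++ map (λ w → x ∷ z ∷ w) (insertions y zs) ++
              map (z ∷_) (concatMap (insertions x) (insertions y zs)))
  expand x y = ↭-prep _ (↭-prep _ (++⁺ (↭-reflexive (sym (map-∘ (insertions x zs)))) (begin
    concatMap (insertions x) (map (z ∷_) (insertions y zs))
      ≡⟨ concatMap-map (insertions x) (z ∷_) (insertions y zs) ⟩
    concatMap (λ w → (x ∷ z ∷ w) ∷ map (z ∷_) (insertions x w)) (insertions y zs)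
      ↭⟨ concatMap-∷ (λ w → x ∷ z ∷ w) (λ w → map (z ∷_) (insertions x w)) (insertions y zs) ⟩
    map (λ w → x ∷ z ∷ w) (insertions y zs) ++ concatMap (λ w → map (z ∷_) (insertions x w)) (insertions y zs)
      ≡⟨ cong (map (λ w → x ∷ z ∷ w) (insertions y zs) ++_) (map-concatMap (z ∷_) (insertions x) (insertions y zs)) ⟨
    map (λ w → x ∷ z ∷ w) (insertions y zs) ++ map (z ∷_) (concatMap (insertions x) (insertions y zs)) ∎)))

permutations⁺ : {L L′ : List A} → L ↭ L′ → permutations L ↭ permutations L′
permutations⁺ ↭.refl                = ↭-refl
permutations⁺ (↭.prep x L↭L′)       = concatMap-↭ (insertions x) (permutations⁺ L↭L′)
permutations⁺ (↭.swap {xs = xs} {ys = ys} x y L↭L′) = begin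
  concatMap (insertions x) (concatMap (insertions y) (permutations xs))
    ↭⟨ concatMap-↭ (insertions x) (concatMap-↭ (insertions y) (permutations⁺ L↭L′)) ⟩
  concatMap (insertions x) (concatMap (insertions y) (permutations ys))
    ≡⟨ concatMap-concatMap (insertions x) (insertions y) (permutations ys) ⟩
  concatMap (λ p → concatMap (insertions x) (insertions y p)) (permutations ys)
    ↭⟨ concatMap-cong-↭ (insertions-comm x y) (permutations ys) ⟩
  concatMap (λ p → concatMap (insertions y) (insertions x p)) (permutations ys)
    ≡⟨ concatMap-concatMap (insertions y) (insertions x) (permutations ys) ⟨
  concatMap (insertions y) (concatMap (insertions x) (permutations ys))  ∎
  where open ↭.PermutationReasoning
permutations⁺ (↭.trans L↭L′ L′↭L″) = ↭-trans (permutations⁺ L↭L′) (permutations⁺ L′↭L″)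

selections : List A → List (A × List A)
selections []       = []
selections (x ∷ xs) = (x , xs) ∷ map (map₂ (x ∷_)) (selections xs)

selections-↭ : (L : List A) → All (λ q → proj₁ q ∷ proj₂ q ↭ L) (selections L)
selections-↭ []       = []
selections-↭ (x ∷ xs) = ↭-refl ∷ All.map⁺ (All.map
  (λ {q} q↭xs → ↭-trans (↭-swap (proj₁ q) x ↭-refl) (↭-prep x q↭xs)) (selections-↭ xs))

map-proj₁-selections : (L : List A) → map proj₁ (selections L) ≡ L
map-proj₁-selections []       = refl
map-proj₁-selections (x ∷ xs) = cong (x ∷_) (trans (sym (map-∘ (selections xs))) (map-proj₁-selections xs))

startingWith : A × List A → List (List A)
startingWith q = map (proj₁ q ∷_) (permutations (proj₂ q))

mutual
  permutations-by-first : (x : A) (xs : List A) →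
                          permutations (x ∷ xs) ↭ concatMap startingWith (selections (x ∷ xs))
  permutations-by-first x xs = begin
    concatMap (insertions x) (permutations xs)
      ≡⟨ concatMap-cong (insertions-∷ x) (permutations xs) ⟩
    concatMap (λ p → (x ∷ p) ∷ laterInsertions x p) (permutations xs)
      ↭⟨ concatMap-∷ (x ∷_) (laterInsertions x) (permutations xs) ⟩
    startingWith (x , xs) ++ concatMap (laterInsertions x) (permutations xs)
      ↭⟨ ++⁺ˡ (startingWith (x , xs)) (laterInsertions-by-first x xs) ⟩
    startingWith (x , xs) ++ concatMap startingWith (map (map₂ (x ∷_)) (selections xs)) ∎
    where open ↭.PermutationReasoning

  laterInsertions-by-first : (x : A) (xs : List A) →
    concatMap (laterInsertions x) (permutations xs) ↭ concatMap startingWith (map (map₂ (x ∷_)) (selections xs))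
  laterInsertions-by-first x []       = ↭-refl
  laterInsertions-by-first x (y ∷ ys) = begin
    concatMap (laterInsertions x) (permutations (y ∷ ys))
      ↭⟨ concatMap-↭ (laterInsertions x) (permutations-by-first y ys) ⟩
    concatMap (laterInsertions x) (concatMap startingWith (selections (y ∷ ys)))
      ≡⟨ concatMap-concatMap (laterInsertions x) startingWith (selections (y ∷ ys)) ⟩
    concatMap (λ q → concatMap (laterInsertions x) (startingWith q)) (selections (y ∷ ys))
      ≡⟨ concatMap-cong insert-x (selections (y ∷ ys)) ⟩
    concatMap (λ q → startingWith (map₂ (x ∷_) q)) (selections (y ∷ ys))
      ≡⟨ concatMap-map startingWith (map₂ (x ∷_)) (selections (y ∷ ys)) ⟨
    concatMap startingWith (map (map₂ (x ∷_)) (selections (y ∷ ys))) ∎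
    where
    open ↭.PermutationReasoning
    insert-x : ∀ q → concatMap (laterInsertions x) (startingWith q) ≡ startingWith (map₂ (x ∷_) q)
    insert-x q = trans (concatMap-map (laterInsertions x) (proj₁ q ∷_) (permutations (proj₂ q)))
                       (sym (map-concatMap (proj₁ q ∷_) (insertions x) (permutations (proj₂ q))))

∑-permutations-by-first : (F : List A → ℚ) (x : A) (xs : List A) →
  ∑ F (permutations (x ∷ xs)) ≡ ∑ (λ q → ∑ F (startingWith q)) (selections (x ∷ xs))
∑-permutations-by-first F x xs =
  trans (∑-↭ F (permutations-by-first x xs)) (∑-concatMap F startingWith (selections (x ∷ xs)))

∑-selections-linear : (g : A → ℚ) (b d : ℚ) (L : List A) →
  ∑ (λ q → b - d * g (proj₁ q)) (selections L) ≡ fromℕ (length L) * b - d * ∑ g L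
∑-selections-linear g b d L = begin
  ∑ (λ q → b - d * g (proj₁ q)) (selections L)
    ≡⟨ ∑-linear (λ _ → b) (g ∘ proj₁) d (selections L) ⟩
  ∑ (λ _ → b) (selections L) - d * ∑ (g ∘ proj₁) (selections L)
    ≡⟨ cong₂ (λ s t → s - d * t) (∑-const b (selections L)) (sym (∑-map g proj₁ (selections L))) ⟩
  fromℕ (length (selections L)) * b - d * ∑ g (map proj₁ (selections L))
    ≡⟨ cong₂ (λ l L′ → fromℕ l * b - d * ∑ g L′) |selections| (map-proj₁-selections L) ⟩
  fromℕ (length L) * b - d * ∑ g L
    ∎
  where
  open ≡-Reasoning
  |selections| : length (selections L) ≡ length L
  |selections| = trans (sym (length-map proj₁ (selections L))) (cong length (map-proj₁-selections L))

0<length-permutations : (L : List A) → 0 < length (permutations L)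
0<length-permutations L = subst (0 <_) (sym (length-permutations L)) (ℕₚ.1≤n! (length L))

∑-permutations : (F : List A → ℚ) (L : List A) →
                 ∑ F (permutations L) ≡ fromℕ (length L !) * average (map F (permutations L))
∑-permutations F L =
  trans (∑≡length*average F (permutations L) (0<length-permutations L))
        (cong (λ k → fromℕ k * average (map F (permutations L))) (length-permutations L))

average-permutations-≥ : (F : List A → ℚ) (L : List A) {b : ℚ} →
                         fromℕ (length L !) * b ≤ℚ ∑ F (permutations L) → b ≤ℚ average (map F (permutations L))
average-permutations-≥ F L {b} n!b≤s =
  average-≥ F (permutations L) (0<length-permutations L)
            (subst (λ k → fromℕ k * b ≤ℚ ∑ F (permutations L)) (sym (length-permutations L)) n!b≤s)

x∈p─q⇒x∉q : ∀ {k} {p q : Subset k} {x} → x ∈ p ─ q → x ∉ q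
x∈p─q⇒x∉q {p = _ ∷ p} {inside  ∷ q} {Fin.zero}  ()
x∈p─q⇒x∉q {p = _ ∷ p} {outside ∷ q} {Fin.zero}  _          ()
x∈p─q⇒x∉q {p = _ ∷ p} {_       ∷ q} {Fin.suc x} (there x∈) (there x∈q) = x∈p─q⇒x∉q {p = p} x∈ x∈q

x∈p-y⇔x∈p×x≢y : ∀ {k} {p : Subset k} {x y} → x ∈ p Sub.- y ⇔ (x ∈ p × x ≢ y)
x∈p-y⇔x∈p×x≢y {p = p} {x} {y} = mk⇔
  (λ x∈p-y → p─q⊆p p ⁅ y ⁆ x∈p-y ,
             λ x≡y → x∈p─q⇒x∉q {p = p} x∈p-y (subst (_∈ ⁅ y ⁆) (sym x≡y) (x∈⁅x⁆ y)))
  (λ (x∈p , x≢y) → x∈p∧x≢y⇒x∈p-y x∈p x≢y)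

toList-tabulate : ∀ {k} (f : Fin k → A) → Vec.toList (Vec.tabulate f) ≡ List.tabulate f
toList-tabulate {k = zero}  f = refl
toList-tabulate {k = suc k} f = cong (f Fin.zero ∷_) (toList-tabulate (f ∘ Fin.suc))

length-filter-∈-suc : ∀ {k} b (Q : Subset k) (l : List (Fin k)) →
                      length (filter (_∈? b ∷ Q) (map Fin.suc l)) ≡ length (filter (_∈? Q) l)
length-filter-∈-suc b Q []      = refl
length-filter-∈-suc b Q (i ∷ l) with does (i ∈? Q)
... | true  = cong suc (length-filter-∈-suc b Q l)
... | false = length-filter-∈-suc b Q l

length-filter-∈ : ∀ {k} (Q : Subset k) → length (filter (_∈? Q) (List.allFin k)) ≡ ∣ Q ∣
length-filter-∈ []      = refl
length-filter-∈ {suc k} (b ∷ Q) with trans (length-filter-∈-suc b Q (List.allFin k)) (length-filter-∈ Q)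
... | |filter|≡∣Q∣ rewrite sym (map-tabulate {n = k} id Fin.suc) with b
...   | inside  = cong suc |filter|≡∣Q∣
...   | outside = |filter|≡∣Q∣

-- The sequence α

β : ℕ → ℕ → ℚ
β m k = 1ℚ - (+ 2 / 1) * αsum m k

α-active : ∀ {m k} → m < 2 ℕ.* suc k → α m (suc k) ≡ β m k
α-active {m} {k} active = cong (if_then β m k else 0ℚ) (dec-true (m <? 2 ℕ.* suc k) active)

α-inactive : ∀ {m k} → ¬ m < 2 ℕ.* suc k → α m (suc k) ≡ 0ℚ
α-inactive {m} {k} inactive = cong (if_then β m k else 0ℚ) (dec-false (m <? 2 ℕ.* suc k) inactive)

αsum-inactive : ∀ {m} k → 2 ℕ.* k ≤ m → αsum m k ≡ 0ℚ
αsum-inactive zero    _      = refl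
αsum-inactive {m} (suc k) 2k+2≤m = begin
  αsum m k + α m (suc k) * (+ 1 / suc k) ≡⟨ cong₂ (λ s a → s + a * (+ 1 / suc k)) (αsum-inactive k 2k≤m)
                                                                                    (α-inactive (ℕₚ.≤⇒≯ 2k+2≤m)) ⟩
  0ℚ + 0ℚ * (+ 1 / suc k)                ≡⟨ cong (_+_ 0ℚ) (ℚ.*-zeroˡ (+ 1 / suc k)) ⟩
  0ℚ                                      ∎
  where
  open ≡-Reasoning
  2k≤m = ℕₚ.≤-trans (ℕₚ.*-monoʳ-≤ 2 (ℕₚ.n≤1+n k)) 2k+2≤m

β-inactive : ∀ {m} k → 2 ℕ.* k ≤ m → β m k ≡ 1ℚ
β-inactive k 2k≤m = cong (λ s → 1ℚ - (+ 2 / 1) * s) (αsum-inactive k 2k≤m)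

β-suc : ∀ m k → β m (suc k) ≡ β m k - (+ 2 / 1) * α m (suc k) * (+ 1 / suc k)
β-suc m k = lemma (αsum m k) (α m (suc k)) (+ 1 / suc k) (+ 2 / 1)
  where
  lemma : ∀ s a r c → 1ℚ - c * (s + a * r) ≡ 1ℚ - c * s - c * a * r
  lemma = solve-∀ ℚ-ring

2/[2+i]≤1 : ∀ i → (+ 2 / 1) * (+ 1 / suc (suc i)) ≤ℚ 1ℚ
2/[2+i]≤1 i = begin
  (+ 2 / 1) * r                        ≤⟨ ℚ.*-monoʳ-≤-nonNeg r {{nonNegative (1/suc-nonNeg (suc i))}} 2≤2+i ⟩
  fromℕ (suc (suc i)) * r               ≡⟨ fromℕ-suc*inverse (suc i) ⟩
  1ℚ                                   ∎
  where
  open ℚ.≤-Reasoning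
  r = + 1 / suc (suc i)
  2≤2+i : + 2 / 1 ≤ℚ fromℕ (suc (suc i))
  2≤2+i = ≤-trans (+-mono-≤ (≤-refl {1ℚ}) (+-mono-≤ (≤-refl {1ℚ}) (fromℕ-nonNeg i)))
                  (≤-reflexive (sym (trans (fromℕ-suc (suc i)) (cong (_+_ 1ℚ) (fromℕ-suc i)))))

β-nonNeg : ∀ m k → m < 2 ℕ.* suc k → suc k ≤ m → 0ℚ ≤ℚ β m k
β-nonNeg m zero    _      _     = ≤-trans (nonNegative⁻¹ 1ℚ) (≤-reflexive (sym (β-inactive {m} 0 ℕ.z≤n)))
β-nonNeg m (suc j) active j+2≤m with m <? 2 ℕ.* suc j
... | no  inactive = ≤-trans (nonNegative⁻¹ 1ℚ) (≤-reflexive (sym (β-inactive (suc j) (ℕₚ.≮⇒≥ inactive))))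
... | yes j-active = ≤-trans (*-nonNeg (β-nonNeg m j j-active (ℕₚ.≤-trans (ℕₚ.n≤1+n _) j+2≤m))
                                      (q≤1⇒0≤1-q (2/[1+j]≤1 j j-active j+2≤m)))
                             (≤-reflexive (sym (begin
  β m (suc j)                                     ≡⟨ β-suc m j ⟩
  β m j - (+ 2 / 1) * α m (suc j) * r              ≡⟨ cong (λ a → β m j - (+ 2 / 1) * a * r) (α-active j-active) ⟩
  β m j - (+ 2 / 1) * β m j * r                    ≡⟨ lemma (β m j) r ⟩
  β m j * (1ℚ - (+ 2 / 1) * r)                     ∎)))
  where
  open ≡-Reasoning
  r = + 1 / suc j
  lemma : ∀ b r → b - (+ 2 / 1) * b * r ≡ b * (1ℚ - (+ 2 / 1) * r)
  lemma = solve-∀ ℚ-ring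
  2/[1+j]≤1 : ∀ j → m < 2 ℕ.* suc j → suc (suc j) ≤ m → (+ 2 / 1) * (+ 1 / suc j) ≤ℚ 1ℚ
  2/[1+j]≤1 zero    m<2 2≤m = contradiction 2≤m (ℕₚ.<⇒≱ m<2)
  2/[1+j]≤1 (suc i) _   _   = 2/[2+i]≤1 i

α-nonNeg : ∀ m t → t ≤ m → 0ℚ ≤ℚ α m t
α-nonNeg m zero    _   = ≤-refl
α-nonNeg m (suc k) t≤m with m <? 2 ℕ.* suc k
... | yes active   = ≤-trans (β-nonNeg m k active t≤m) (≤-reflexive (sym (α-active active)))
... | no  inactive = ≤-reflexive (sym (α-inactive inactive))

α-suc-≤ : ∀ m k {X} → 0ℚ ≤ℚ X → β m k ≤ℚ X → α m (suc k) ≤ℚ X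
α-suc-≤ m k 0≤X β≤X with m <? 2 ℕ.* suc k
... | yes active   = ≤-trans (≤-reflexive (α-active active)) β≤X
... | no  inactive = ≤-trans (≤-reflexive (α-inactive inactive)) 0≤X

module _ (n m : ℕ) (ends : Fin m → Fin n × Fin n) (w : Fin m → ℚ) where
  open Graph n m ends w

  Incident : Fin n → Fin m → Set
  Incident u y = u ≡ proj₁ (ends y) ⊎ u ≡ proj₂ (ends y)

  Touches : Fin m → Fin m → Set
  Touches y e = Incident (proj₁ (ends e)) y ⊎ Incident (proj₂ (ends e)) y

  incident? : ∀ u y → Dec (Incident u y)
  incident? u y = (u Fin.≟ _) ⊎-dec (u Fin.≟ _)

  touches? : ∀ y e → Dec (Touches y e)
  touches? y e = incident? _ y ⊎-dec incident? _ y

  removeEnds : Fin m → Subset n → Subset n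
  removeEnds y A = (A Sub.- proj₁ (ends y)) Sub.- proj₂ (ends y)

  ∈-removeEnds : ∀ {u y A} → u ∈ removeEnds y A ⇔ (u ∈ A × ¬ Incident u y)
  ∈-removeEnds = mk⇔
    (λ u∈ → let (u∈A-y₁ , u≢y₂) = to x∈p-y⇔x∈p×x≢y u∈
                (u∈A , u≢y₁)    = to x∈p-y⇔x∈p×x≢y u∈A-y₁
            in u∈A , [ u≢y₁ , u≢y₂ ])
    (λ (u∈A , ¬inc) → from x∈p-y⇔x∈p×x≢y (from x∈p-y⇔x∈p×x≢y (u∈A , ¬inc ∘ inj₁) , ¬inc ∘ inj₂))

  bothAvailable-removeEnds : ∀ {e y A} →
    BothAvailable e (removeEnds y A) ⇔ (BothAvailable e A × ¬ Touches y e)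
  bothAvailable-removeEnds = mk⇔
    (λ (u∈ , v∈) → let (u∈A , ¬u) = to ∈-removeEnds u∈
                       (v∈A , ¬v) = to ∈-removeEnds v∈
                   in (u∈A , v∈A) , [ ¬u , ¬v ])
    (λ ((u∈A , v∈A) , ¬touch) → from ∈-removeEnds (u∈A , ¬touch ∘ inj₁) , from ∈-removeEnds (v∈A , ¬touch ∘ inj₂))

  does-bothAvailable-removeEnds : ∀ e y A →
    does (bothAvailable? e (removeEnds y A)) ≡ does (bothAvailable? e A) ∧ not (does (touches? y e))
  does-bothAvailable-removeEnds e y A =
    does-⇔ bothAvailable-removeEnds (bothAvailable? e (removeEnds y A)) (bothAvailable? e A ×-dec ¬? (touches? y e))

  -- One round of the algorithm

  ratio-nonNeg : ∀ {a x} → 0ℚ ≤ℚ a → 0ℚ ≤ℚ x → 0ℚ ≤ℚ ratio a x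
  ratio-nonNeg {a} {x} 0≤a 0≤x with x ℚ.≟ 0ℚ
  ... | yes _   = ≤-refl
  ... | no  x≢0 = *-nonNeg 0≤a (1/-nonNeg x 0≤x x≢0)

  ratio-≤1 : ∀ {a x} → a ≤ℚ x → 0ℚ ≤ℚ x → ratio a x ≤ℚ 1ℚ
  ratio-≤1 {a} {x} a≤x 0≤x with x ℚ.≟ 0ℚ
  ... | yes _   = nonNegative⁻¹ 1ℚ
  ... | no  x≢0 = ≤-trans (ℚ.*-monoʳ-≤-nonNeg _ {{nonNegative (1/-nonNeg x 0≤x x≢0)}} a≤x)
                          (≤-reflexive (ℚ.*-inverseʳ x {{≢-nonZero x≢0}}))

  ratio*x≤a : ∀ {a} x → 0ℚ ≤ℚ a → ratio a x * x ≤ℚ a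
  ratio*x≤a {a} x 0≤a with x ℚ.≟ 0ℚ
  ... | yes _   = ≤-trans (≤-reflexive (ℚ.*-zeroˡ x)) 0≤a
  ... | no  x≢0 = ≤-reflexive (begin
    a * (1/ x) * x     ≡⟨ ℚ.*-assoc a _ x ⟩
    a * ((1/ x) * x)   ≡⟨ cong (a *_) (ℚ.*-inverseˡ x) ⟩
    a * 1ℚ             ≡⟨ ℚ.*-identityʳ a ⟩
    a                  ∎)
    where
    open ≡-Reasoning
    instance _ = ≢-nonZero x≢0

  NonNegDist : Dist → Set
  NonNegDist D = All (λ pA → 0ℚ ≤ℚ proj₁ pA) D

  avail : Fin m → ℚ × Subset n → ℚ
  avail e pA = if does (bothAvailable? e (proj₂ pA)) then proj₁ pA else 0ℚ

  avail-nonNeg : ∀ e pA → 0ℚ ≤ℚ proj₁ pA → 0ℚ ≤ℚ avail e pA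
  avail-nonNeg e (p , A) 0≤p with does (bothAvailable? e A)
  ... | true  = 0≤p
  ... | false = ≤-refl

  probAvail-nonNeg : ∀ e D → NonNegDist D → 0ℚ ≤ℚ probAvail e D
  probAvail-nonNeg e D nonNeg = ∑-nonNeg D (All.map (avail-nonNeg e _) nonNeg)

  -- Definitionally the local branch of step.
  split : ℚ → Fin m → ℚ × Subset n → Dist
  split q y (p , A) =
    if does (bothAvailable? y A)
    then (p * q , removeEnds y A) ∷ (p * (1ℚ - q) , A) ∷ []
    else (p , A) ∷ []

  split-nonNeg : ∀ y {q} pA → 0ℚ ≤ℚ proj₁ pA → 0ℚ ≤ℚ q → q ≤ℚ 1ℚ → NonNegDist (split q y pA)
  split-nonNeg y (p , A) 0≤p 0≤q q≤1 with does (bothAvailable? y A)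
  ... | true  = *-nonNeg 0≤p 0≤q ∷ *-nonNeg 0≤p (q≤1⇒0≤1-q q≤1) ∷ []
  ... | false = 0≤p ∷ []

  avail-split : ∀ e y {q} pA → 0ℚ ≤ℚ proj₁ pA → 0ℚ ≤ℚ q →
    avail e pA - 𝟙 (touches? y e) * q * avail y pA ≤ℚ ∑ (avail e) (split q y pA)
  avail-split e y {q} (p , A) 0≤p 0≤q with does (bothAvailable? y A)
  ... | false = ≤-reflexive (lemma₁ (avail e (p , A)) (𝟙 (touches? y e)) q)
    where
    lemma₁ : ∀ a c q → a - c * q * 0ℚ ≡ a + 0ℚ
    lemma₁ = solve-∀ ℚ-ring
  ... | true rewrite does-bothAvailable-removeEnds e y A with does (bothAvailable? e A)
  ...   | false = p-q≤p 0ℚ (*-nonNeg (*-nonNeg (𝟙-nonNeg (touches? y e)) 0≤q) 0≤p)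
  ...   | true with does (touches? y e)
  ...     | true  = ≤-reflexive (lemma₂ p q)
    where
    lemma₂ : ∀ p q → p - 1ℚ * q * p ≡ 0ℚ + (p * (1ℚ - q) + 0ℚ)
    lemma₂ = solve-∀ ℚ-ring
  ...     | false = ≤-reflexive (lemma₃ p q)
    where
    lemma₃ : ∀ p q → p - 0ℚ * q * p ≡ p * q + (p * (1ℚ - q) + 0ℚ)
    lemma₃ = solve-∀ ℚ-ring

  Blocks : Subset m → Fin m → Fin m → Set
  Blocks S e y = InMaxMatching S y × Touches y e

  blocks? : ∀ S e y → Dec (Blocks S e y)
  blocks? S e y = inMaxMatching? S y ×-dec touches? y e

  module _ (t : ℕ) (y : Fin m) (S : Subset m) (x : ℚ) (D : Dist) (nonNeg : NonNegDist D)
           (0≤q : 0ℚ ≤ℚ ratio (α m t) x) (q≤1 : ratio (α m t) x ≤ℚ 1ℚ) where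

    step-nonNeg : NonNegDist (step t y S x D)
    step-nonNeg with m ℕ.<ᵇ 2 ℕ.* t | does (inMaxMatching? S y)
    ... | false | _     = nonNeg
    ... | true  | false = nonNeg
    ... | true  | true  = All.concat⁺ (All.map⁺ (All.map (λ {pA} 0≤p → split-nonNeg y pA 0≤p 0≤q q≤1) nonNeg))

    probAvail-step : ∀ e →
      probAvail e D - 𝟙 (blocks? S e y) * ratio (α m t) x * probAvail y D ≤ℚ probAvail e (step t y S x D)
    probAvail-step e with m ℕ.<ᵇ 2 ℕ.* t
    ... | false = p-q≤p _ (*-nonNeg (*-nonNeg (𝟙-nonNeg (blocks? S e y)) 0≤q) (probAvail-nonNeg y D nonNeg))
    ... | true with does (inMaxMatching? S y)
    ...   | false = p-q≤p _ (*-nonNeg (*-nonNeg ≤-refl 0≤q) (probAvail-nonNeg y D nonNeg))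
    ...   | true  = begin
      probAvail e D - 𝟙 (touches? y e) * q * probAvail y D     ≡⟨ ∑-linear (avail e) (avail y) (𝟙 (touches? y e) * q) D ⟨
      ∑ (λ pA → avail e pA - 𝟙 (touches? y e) * q * avail y pA) D
        ≤⟨ ∑-mono D (All.map (λ {pA} 0≤p → avail-split e y pA 0≤p 0≤q) nonNeg) ⟩
      ∑ (λ pA → ∑ (avail e) (split q y pA)) D                    ≡⟨ ∑-concatMap (avail e) (split q y) D ⟨
      ∑ (avail e) (concatMap (split q y) D)                      ∎
      where
      open ℚ.≤-Reasoning
      q = ratio (α m t) x

  -- Edges of the maximum weight matching that touch e

  incident-unique : ∀ {S M u a b} → IsMatching S M → a ∈ M → b ∈ M → Incident u a → Incident u b → a ≡ b
  incident-unique {a = a} {b} (_ , disjoint) a∈M b∈M u-a u-b with a Fin.≟ b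
  ... | yes a≡b = a≡b
  ... | no  a≢b with disjoint a b a∈M b∈M a≢b | u-a | u-b
  ...   | d , _ , _ , _ | inj₁ refl | inj₁ eq = contradiction eq d
  ...   | _ , d , _ , _ | inj₁ refl | inj₂ eq = contradiction eq d
  ...   | _ , _ , d , _ | inj₂ refl | inj₁ eq = contradiction eq d
  ...   | _ , _ , _ , d | inj₂ refl | inj₂ eq = contradiction eq d

  ∑-blocks≤2 : UniqueMaxWeightMatchings →
               ∀ S e (L : List (Fin m)) → Unique L → ∑ (λ y → 𝟙 (blocks? S e y)) L ≤ℚ + 2 / 1
  ∑-blocks≤2 unique S e L uL with anySubset? (isMaxWeightMatching? S)
  ... | no noMax = ≤-trans (≤-reflexive (∑-𝟙-none (blocks? S e) L (All.universal noBlocks L))) (nonNegative⁻¹ (+ 2 / 1))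
    where
    noBlocks : ∀ y → ¬ Blocks S e y
    noBlocks _ ((M , isMax , _) , _) = noMax (M , isMax)
  ... | yes (M , isMax) = begin
    ∑ (λ y → 𝟙 (blocks? S e y)) L                       ≤⟨ ∑-mono L (All.universal 𝟙-blocks≤ L) ⟩
    ∑ (λ y → 𝟙 (at? u₁ y) + 𝟙 (at? u₂ y)) L             ≡⟨ ∑-+ (λ y → 𝟙 (at? u₁ y)) (λ y → 𝟙 (at? u₂ y)) L ⟩
    ∑ (λ y → 𝟙 (at? u₁ y)) L + ∑ (λ y → 𝟙 (at? u₂ y)) L ≤⟨ +-mono-≤ (∑-𝟙-≤1 (at? u₁) at-unique L uL)
                                                                    (∑-𝟙-≤1 (at? u₂) at-unique L uL) ⟩
    1ℚ + 1ℚ                                             ∎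
    where
    open ℚ.≤-Reasoning
    u₁ = proj₁ (ends e)
    u₂ = proj₂ (ends e)
    At : Fin n → Fin m → Set
    At u y = y ∈ M × Incident u y
    at? : ∀ u y → Dec (At u y)
    at? u y = (y ∈? M) ×-dec incident? u y
    at-unique : ∀ {u a b} → At u a → At u b → a ≡ b
    at-unique (a∈M , u-a) (b∈M , u-b) = incident-unique (proj₁ isMax) a∈M b∈M u-a u-b
    blocks⇒at : ∀ y → Blocks S e y → At u₁ y ⊎ At u₂ y
    blocks⇒at y ((M′ , isMax′ , y∈M′) , touch) with unique S M′ M isMax′ isMax
    ... | refl = Data.Sum.map (y∈M′ ,_) (y∈M′ ,_) touch
    𝟙-blocks≤ : ∀ y → 𝟙 (blocks? S e y) ≤ℚ 𝟙 (at? u₁ y) + 𝟙 (at? u₂ y)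
    𝟙-blocks≤ y = ≤-trans (𝟙-mono (blocks? S e y) (at? u₁ y ⊎-dec at? u₂ y) (blocks⇒at y)) (𝟙-⊎ (at? u₁ y) (at? u₂ y))

  -- Induction on the number of processed edges

  length-elements : ∀ Q → length (elements Q) ≡ ∣ Q ∣
  length-elements Q = trans (cong (λ l → length (filter (_∈? Q) l)) (toList-tabulate id)) (length-filter-∈ Q)

  elements-unique : ∀ Q → Unique (elements Q)
  elements-unique Q = Uniqueₚ.filter⁺ (_∈? Q) (subst Unique (sym (toList-tabulate id)) (Uniqueₚ.allFin⁺ m))

  setOf-↭ : {l l′ : List (Fin m)} → l ↭ l′ → setOf l ≡ setOf l′
  setOf-↭ ↭.refl                = refl
  setOf-↭ (↭.prep x l↭l′)       = cong (⁅ x ⁆ ∪_) (setOf-↭ l↭l′)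
  setOf-↭ (↭.swap {xs = l} {ys = l′} x y l↭l′) = begin
    ⁅ x ⁆ ∪ (⁅ y ⁆ ∪ setOf l)   ≡⟨ cong (λ S → ⁅ x ⁆ ∪ (⁅ y ⁆ ∪ S)) (setOf-↭ l↭l′) ⟩
    ⁅ x ⁆ ∪ (⁅ y ⁆ ∪ setOf l′)  ≡⟨ ∪-assoc ⁅ x ⁆ ⁅ y ⁆ (setOf l′) ⟨
    (⁅ x ⁆ ∪ ⁅ y ⁆) ∪ setOf l′  ≡⟨ cong (_∪ setOf l′) (∪-comm ⁅ x ⁆ ⁅ y ⁆) ⟩
    (⁅ y ⁆ ∪ ⁅ x ⁆) ∪ setOf l′  ≡⟨ ∪-assoc ⁅ y ⁆ ⁅ x ⁆ (setOf l′) ⟩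
    ⁅ y ⁆ ∪ (⁅ x ⁆ ∪ setOf l′)  ∎
    where open ≡-Reasoning
  setOf-↭ (↭.trans l↭l′ l′↭l″)  = trans (setOf-↭ l↭l′) (setOf-↭ l′↭l″)

  xR-↭ : ∀ k y {ρ ρ′} → ρ ↭ ρ′ → xR k ρ y ≡ xR k ρ′ y
  xR-↭ k y ρ↭ρ′ = average-↭ (λ π → probAvail y (distR k π)) (permutations⁺ ρ↭ρ′)

  Invariant : ℕ → Set
  Invariant k = ∀ L → Unique L → length L ≡ k → NonNegDist (distR k L) × (∀ e → β m k ≤ℚ xR k L e)

  module _ {k : ℕ} (inv : Invariant k) {L : List (Fin m)} (uL : Unique L) (|L|≡k : length L ≡ k) where

    xR-nonNeg : ∀ e → 0ℚ ≤ℚ xR k L e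
    xR-nonNeg e = average-nonNeg (λ π → probAvail e (distR k π)) (permutations L) (All.map
      (λ π↭L → probAvail-nonNeg e _ (proj₁ (inv _ (Unique-↭ (↭-sym π↭L) uL) (trans (↭-length π↭L) |L|≡k))))
      (permutations-↭ L))

    α≤xR : ∀ e → α m (suc k) ≤ℚ xR k L e
    α≤xR e = α-suc-≤ m k (xR-nonNeg e) (proj₂ (inv L uL |L|≡k) e)

  distR-nonNeg-suc : ∀ {k} → suc k ≤ m → Invariant k →
                     ∀ y ρ → Unique (y ∷ ρ) → length ρ ≡ k → NonNegDist (distR (suc k) (y ∷ ρ))
  distR-nonNeg-suc k<m inv y ρ (_ ∷ uρ) refl =
    step-nonNeg (suc (length ρ)) y (setOf (y ∷ ρ)) (xR _ ρ y) (distR _ ρ) (proj₁ (inv ρ uρ refl))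
      (ratio-nonNeg (α-nonNeg m (suc (length ρ)) k<m) (xR-nonNeg inv uρ refl y))
      (ratio-≤1 (α≤xR inv uρ refl y) (xR-nonNeg inv uρ refl y))

  ∑-lastEdge-≥ : ∀ {k} → suc k ≤ m → Invariant k →
    ∀ {L} y ys → y ∷ ys ↭ L → Unique L → length ys ≡ k → ∀ e →
    fromℕ (k !) * β m k - fromℕ (k !) * α m (suc k) * 𝟙 (blocks? (setOf L) e y)
      ≤ℚ ∑ (λ π → probAvail e (distR (suc k) π)) (startingWith (y , ys))
  ∑-lastEdge-≥ {k} k<m inv {L} y ys y∷ys↭L uL refl e = begin
    K * β m k - K * a * c                                  ≤⟨ -‿mono-≤ Kβ≤Kx cqKx≤Kac ⟩
    K * xR k ys e - c * q * (K * xR k ys y)                ≡⟨ cong₂ (λ s s′ → s - c * q * s′) (∑-permutations (G e) ys)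
                                                                                             (∑-permutations (G y) ys) ⟨
    ∑ (G e) (permutations ys) - c * q * ∑ (G y) (permutations ys)
                                                           ≡⟨ ∑-linear (G e) (G y) (c * q) (permutations ys) ⟨
    ∑ (λ ρ → G e ρ - c * q * G y ρ) (permutations ys)      ≤⟨ ∑-mono (permutations ys) (All.map perOrder (permutations-↭ ys)) ⟩
    ∑ (λ ρ → F (y ∷ ρ)) (permutations ys)                  ≡⟨ ∑-map F (y ∷_) (permutations ys) ⟨
    ∑ F (startingWith (y , ys))                            ∎
    where
    open ℚ.≤-Reasoning
    uys : Unique ys
    uys with _ ∷ uys ← Unique-↭ (↭-sym y∷ys↭L) uL = uys
    K = fromℕ (k !)
    a = α m (suc k)
    c = 𝟙 (blocks? (setOf L) e y)
    q = ratio a (xR k ys y)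
    G : Fin m → List (Fin m) → ℚ
    G z ρ = probAvail z (distR k ρ)
    F : List (Fin m) → ℚ
    F π = probAvail e (distR (suc k) π)
    0≤K : 0ℚ ≤ℚ K
    0≤K = fromℕ-nonNeg (k !)
    0≤x : 0ℚ ≤ℚ xR k ys y
    0≤x = xR-nonNeg inv uys refl y
    0≤q : 0ℚ ≤ℚ q
    0≤q = ratio-nonNeg (α-nonNeg m (suc k) k<m) 0≤x
    q≤1 : q ≤ℚ 1ℚ
    q≤1 = ratio-≤1 (α≤xR inv uys refl y) 0≤x
    Kβ≤Kx : K * β m k ≤ℚ K * xR k ys e
    Kβ≤Kx = ℚ.*-monoˡ-≤-nonNeg K {{nonNegative 0≤K}} (proj₂ (inv ys uys refl) e)
    cqKx≤Kac : c * q * (K * xR k ys y) ≤ℚ K * a * c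
    cqKx≤Kac = begin
      c * q * (K * xR k ys y)   ≡⟨ lemma₁ c q K (xR k ys y) ⟩
      K * c * (q * xR k ys y)   ≤⟨ ℚ.*-monoˡ-≤-nonNeg (K * c) {{nonNegative (*-nonNeg 0≤K (𝟙-nonNeg (blocks? (setOf L) e y)))}}
                                                      (ratio*x≤a (xR k ys y) (α-nonNeg m (suc k) k<m)) ⟩
      K * c * a                 ≡⟨ lemma₂ K c a ⟩
      K * a * c                 ∎
      where
      lemma₁ : ∀ c q K x → c * q * (K * x) ≡ K * c * (q * x)
      lemma₁ = solve-∀ ℚ-ring
      lemma₂ : ∀ K c a → K * c * a ≡ K * a * c
      lemma₂ = solve-∀ ℚ-ring
    round : ∀ {t S x} ρ → t ≡ suc k → S ≡ setOf L → x ≡ xR k ys y → NonNegDist (distR k ρ) →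
            G e ρ - c * q * G y ρ ≤ℚ probAvail e (step t y S x (distR k ρ))
    round ρ refl refl refl nonNeg = probAvail-step (suc k) y (setOf L) (xR k ys y) (distR k ρ) nonNeg 0≤q q≤1 e
    perOrder : ∀ {ρ} → ρ ↭ ys → G e ρ - c * q * G y ρ ≤ℚ F (y ∷ ρ)
    perOrder {ρ} ρ↭ys =
      round ρ (cong suc (↭-length ρ↭ys)) (setOf-↭ (↭-trans (↭-prep y ρ↭ys) y∷ys↭L)) (xR-↭ k y ρ↭ys)
            (proj₁ (inv ρ (Unique-↭ (↭-sym ρ↭ys) uys) (↭-length ρ↭ys)))

  xR-bound-suc : UniqueMaxWeightMatchings → ∀ {k} → suc k ≤ m → Invariant k →
                 ∀ L → Unique L → length L ≡ suc k → ∀ e → β m (suc k) ≤ℚ xR (suc k) L e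
  xR-bound-suc unique {k} k<m inv L@(x ∷ xs) uL refl e = average-permutations-≥ F L (begin
    fromℕ (suc k !) * β m (suc k)                    ≡⟨ count ⟩
    N * (K * β m k) - K * a * (+ 2 / 1)             ≤⟨ -‿mono-≤ (≤-refl {N * (K * β m k)}) Ka∑c≤2Ka ⟩
    N * (K * β m k) - K * a * ∑ c L                 ≡⟨ ∑-selections-linear c (K * β m k) (K * a) L ⟨
    ∑ (λ q → K * β m k - K * a * c (proj₁ q)) (selections L)
      ≤⟨ ∑-mono (selections L) (All.map (λ {q} q↭L → ∑-lastEdge-≥ k<m inv (proj₁ q) (proj₂ q) q↭L uL
                                                       (ℕₚ.suc-injective (↭-length q↭L)) e)
                                        (selections-↭ L)) ⟩
    ∑ (λ q → ∑ F (startingWith q)) (selections L)   ≡⟨ ∑-permutations-by-first F x xs ⟨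
    ∑ F (permutations L)                            ∎)
    where
    open ℚ.≤-Reasoning
    N = fromℕ (suc k)
    K = fromℕ (k !)
    a = α m (suc k)
    F : List (Fin m) → ℚ
    F π = probAvail e (distR (suc k) π)
    c : Fin m → ℚ
    c y = 𝟙 (blocks? (setOf L) e y)
    Ka∑c≤2Ka : K * a * ∑ c L ≤ℚ K * a * (+ 2 / 1)
    Ka∑c≤2Ka = ℚ.*-monoˡ-≤-nonNeg (K * a) {{nonNegative (*-nonNeg (fromℕ-nonNeg (k !)) (α-nonNeg m (suc k) k<m))}}
                                  (∑-blocks≤2 unique (setOf L) e L uL)
    count : fromℕ (suc k !) * β m (suc k) ≡ N * (K * β m k) - K * a * (+ 2 / 1)
    count = begin-equality
      fromℕ (suc k !) * β m (suc k)                 ≡⟨ cong₂ _*_ (fromℕ-* (suc k) (k !)) (β-suc m k) ⟩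
      N * K * (β m k - (+ 2 / 1) * a * r)           ≡⟨ lemma N K (β m k) a r (+ 2 / 1) ⟩
      N * (K * β m k) - K * a * (+ 2 / 1) * (N * r) ≡⟨ cong (λ z → N * (K * β m k) - K * a * (+ 2 / 1) * z) (fromℕ-suc*inverse k) ⟩
      N * (K * β m k) - K * a * (+ 2 / 1) * 1ℚ      ≡⟨ cong (_-_ (N * (K * β m k))) (ℚ.*-identityʳ _) ⟩
      N * (K * β m k) - K * a * (+ 2 / 1)           ∎
      where
      r = + 1 / suc k
      lemma : ∀ N K b a r c → N * K * (b - c * a * r) ≡ N * (K * b) - K * a * c * (N * r)
      lemma = solve-∀ ℚ-ring

  invariant : UniqueMaxWeightMatchings → ∀ k → k ≤ m → Invariant k
  invariant _      zero    _   [] _ _ = nonNegative⁻¹ 1ℚ ∷ [] , everyEdgeAvailable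
    where
    everyEdgeAvailable : ∀ e → β m 0 ≤ℚ xR 0 [] e
    everyEdgeAvailable e rewrite dec-true (bothAvailable? e Sub.⊤) (∈⊤ , ∈⊤) = ≤-refl
  invariant unique (suc k) k<m L uL |L| =
    nonNeg L uL |L| , xR-bound-suc unique k<m inv L uL |L|
    where
    inv = invariant unique k (ℕₚ.≤-trans (ℕₚ.n≤1+n k) k<m)
    nonNeg : ∀ L → Unique L → length L ≡ suc k → NonNegDist (distR (suc k) L)
    nonNeg (y ∷ ρ) uL |L| = distR-nonNeg-suc k<m inv y ρ uL (ℕₚ.suc-injective |L|)

lemma11 : (n m : ℕ) (ends : Fin m → Fin n × Fin n) (w : Fin m → ℚ) →
          IsSimpleGraph ends →
          (∀ e → 0ℚ ≤ℚ w e) →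
          Graph.UniqueMaxWeightMatchings n m ends w →
          (t : ℕ) → 1 ≤ t → t ≤ m →
          (e : Fin m) (Q : Subset m) → e ∉ Q → ∣ Q ∣ ≡ t ∸ 1 →
          α m t ≤ℚ Graph.x n m ends w Q e
lemma11 n m ends w _ _ unique (suc k) _ k<m e Q _ ∣Q∣≡k =
  subst (λ j → α m (suc j) ≤ℚ Graph.x n m ends w Q e) |L|≡k
        (α≤xR n m ends w (invariant n m ends w unique (length L) |L|≤m) (elements-unique n m ends w Q) refl e)
  where
  L = Graph.elements n m ends w Q
  |L|≡k : length L ≡ k
  |L|≡k = trans (length-elements n m ends w Q) ∣Q∣≡k
  |L|≤m : length L ≤ m
  |L|≤m = subst (_≤ m) (sym |L|≡k) (ℕₚ.<⇒≤ k<m)
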